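{- Let $g\geq 2$. For $m\geq1$ define the polynomial $P_m(a_1,\dots,a_m)$ by $$P_m(a_1,\dots,a_m)=\sum_{k=1}^m\frac{(-1)^k(2g-3+k)!}{k!}\sum_{\substack{I_1\sqcup\cdots\sqcup I_k=\{1,\dots,m\}\\ I_j\neq\varnothing\ \forall j}}\ \sum_{\substack{d_1,\dots,d_k\in\mathbb{Z}_{\geq0}\\ d_1+\cdots+d_k=g-2+m}}\prod_{j=1}^k\binom{2a_{[I_j]}+1}{2d_j}\prod_{i=1}^{|I_j|-1}(2d_j+1-2i).$$ Then for every $n\geq1$ and all $a_1,\dots,a_n\in\mathbb{Z}_{\geq0}$, $$P_{n+1}(a_1,\dots,a_n,1)-P_{n+1}(a_1,\dots,a_n,0)=P_n(a_1,\dots,a_n)\Big(4\sum_{i=1}^na_i-8g+10-2n\Big).$$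
   Context: Here $\binom{x}{m}=\frac{x(x-1)\cdots(x-m+1)}{m!}$; $a_{[I]}=\sum_{\ell\in I}a_\ell$; the sum over $I_1\sqcup\cdots\sqcup I_k$ runs over ordered $k$-tuples of nonempty disjoint subsets with union $\{1,\dots,m\}$. -}

module Defs where

open import Data.Nat as ℕ using (ℕ; zero; suc; _!; _∸_; _≤ᵇ_)
open import Data.Nat.Properties using (_!≢0)
open import Data.Nat.Combinatorics using (_C_)
open import Data.Nat.DivMod using (_/_)
open import Data.Integer as ℤ using (ℤ; +_; -_)
open import Data.Fin using (Fin; _≟_)
open import Data.Vec as V using (Vec; []; _∷_)
open import Data.List as L using (List)
open import Data.Bool using (Bool; true; _∧_; if_then_else_)
open import Relation.Nullary using (does)

Σℤ : ∀ {A : Set} → List A → (A → ℤ) → ℤ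
Σℤ xs f = L.foldr (λ x r → f x ℤ.+ r) (+ 0) xs

Πℤ : ∀ {A : Set} → List A → (A → ℤ) → ℤ
Πℤ xs f = L.foldr (λ x r → f x ℤ.* r) (+ 1) xs

-- All maps {1..m} → {1..k}, encoded as vectors (f i = index of the block containing i).
assignments : (m k : ℕ) → List (Vec (Fin k) m)
assignments zero    k = L.[ [] ]
assignments (suc m) k =
  L.concatMap (λ j → L.map (j ∷_) (assignments m k)) (L.allFin k)

blockSize : ∀ {m k} → Vec (Fin k) m → Fin k → ℕ
blockSize f j = V.count (_≟ j) f

blockSum : ∀ {m k} → Vec ℕ m → Vec (Fin k) m → Fin k → ℕ
blockSum []       []       j = 0
blockSum (a ∷ as) (i ∷ f)  j = (if does (i ≟ j) then a else 0) ℕ.+ blockSum as f j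

allᵇ : ∀ {A : Set} → (A → Bool) → List A → Bool
allᵇ p = L.foldr (λ x r → p x ∧ r) true

-- Ordered k-tuples (I_1,…,I_k) of nonempty disjoint subsets with union {1..m}
-- correspond bijectively to surjections {1..m} → {1..k}.
orderedPartitions : (m k : ℕ) → List (Vec (Fin k) m)
orderedPartitions m k =
  L.filterᵇ (λ f → allᵇ (λ j → 1 ≤ᵇ blockSize f j) (L.allFin k)) (assignments m k)

compositions : (k N : ℕ) → List (Vec ℕ k)
compositions zero    zero    = L.[ [] ]
compositions zero    (suc N) = L.[]
compositions (suc k) N =
  L.concatMap (λ d → L.map (d ∷_) (compositions k (N ∸ d))) (L.upTo (suc N))

oddProd : ℕ → ℕ → ℤ
oddProd d zero    = + 1
oddProd d (suc r) = oddProd d r ℤ.* (+ (2 ℕ.* d ℕ.+ 1) ℤ.- + (2 ℕ.* suc r))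

coeff : ℕ → ℕ → ℕ
coeff g k = ((2 ℕ.* g ∸ 3 ℕ.+ k) !) / (k !)
  where instance _ = k !≢0

P : (g m : ℕ) → Vec ℕ m → ℤ
P g m a =
  Σℤ (L.map suc (L.upTo m)) λ k →
    ((- + 1) ℤ.^ k) ℤ.* + coeff g k ℤ.*
    Σℤ (orderedPartitions m k) λ f →
      Σℤ (compositions k (g ∸ 2 ℕ.+ m)) λ d →
        Πℤ (L.allFin k) λ j →
          + ((2 ℕ.* blockSum a f j ℕ.+ 1) C (2 ℕ.* V.lookup d j))
          ℤ.* oddProd (V.lookup d j) (blockSize f j ∸ 1)

-- Write P_m = Σ_k c_k Q_k, where Q_k sums, over surjections f : {1..m} → {1..k} and compositions d of
-- g-2+m into k parts, the products ∏_j B(a_[f⁻¹ j], d_j, |f⁻¹ j|) of block weights.  An appended element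
-- of weight 0 or 1 either joins a block j₀ of a surjection onto k blocks or is alone in block j₀.  In the
-- difference of the two weights, the identity B(s+1, e+1, r+1) - B(s, e+1, r+1) = B(s, e, r) (4s - 2e + 3),
-- after shifting d_{j₀} down by one, turns the first kind into Q_k(a) (4 Σa - 2N + 3k) with N = g-2+n,
-- and the second into 3k Q_{k-1}(a).  The recursion (k+1) c_{k+1} = -(2g-2+k) c_k then collapses the
-- sum over k to P_n(a) (4 Σa - 8g + 10 - 2n).

module Submission where

open import Defs
open import Data.Nat as ℕ using (ℕ; zero; suc; _≤_; _<_; z≤n; s≤s; _∸_; _≤ᵇ_; _≡ᵇ_; _!)
import Data.Nat.Properties as ℕP
open import Data.Nat.Properties using (_!≢0)
open import Data.Nat.Divisibility using (m≤n⇒m!∣n!)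
open import Data.Nat.DivMod using (m/n*n≡m)
open import Data.Nat.Combinatorics using (_C_; nCk+nC[k+1]≡[n+1]C[k+1]; k>n⇒nCk≡0; nC1≡n)
open import Data.Integer as ℤ using (ℤ; +_; -_; _+_; _-_; _*_)
import Data.Integer.Properties as ℤP
open import Data.Integer.Tactic.RingSolver using (solve-∀)
open import Data.Fin as F using (Fin; punchIn; _≟_)
import Data.Fin.Properties as FP
open import Data.Vec as V using (Vec; []; _∷_; _∷ʳ_)
import Data.Vec.Properties as VP
import Data.Vec.Functional as VF
open import Data.List as L using (List)
open import Data.List.Membership.Propositional using (_∈_; find)
open import Data.List.Membership.Propositional.Properties using (∈-concatMap⁻; ∈-map⁻; ∈-upTo⁻)
import Data.List.Properties as LP
open import Data.List.Relation.Unary.Any using (here; there)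
open import Data.Bool using (Bool; true; false; _∧_; if_then_else_)
import Data.Bool.Properties as BoolP
open import Relation.Nullary using (does; yes; no)
open import Data.Empty using (⊥-elim)
open import Relation.Nullary.Decidable using (dec-true; dec-false)
open import Relation.Binary.PropositionalEquality
open import Data.Product using (_,_)
open import Function using (_∘_)
import Algebra.Properties.CommutativeMonoid.Sum as Sum
open Sum ℤP.+-0-commutativeMonoid
  using (sum; sum-syntax; sum-remove; sum-replicate-zero; ∑-distrib-+; sum-cong-≗)
open import Algebra.Properties.Semiring.Sum ℤP.+-*-semiring using (*-distribˡ-sum)
module Product = Sum ℤP.*-1-commutativeMonoid
module Conj = Sum BoolP.∧-commutativeMonoid
module ℕSum = Sum ℕP.+-0-commutativeMonoid

private variable
  A B : Set
  m k : ℕ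

cong₃ : ∀ {A B C D : Set} (h : A → B → C → D) {x x′ y y′ z z′} →
  x ≡ x′ → y ≡ y′ → z ≡ z′ → h x y z ≡ h x′ y′ z′
cong₃ h refl refl refl = refl

*-distribʳ-- : ∀ x y z → (y - z) * x ≡ y * x - z * x
*-distribʳ-- = solve-∀

*-distribˡ-- : ∀ x y z → x * (y - z) ≡ x * y - x * z
*-distribˡ-- = solve-∀

-- Finite sums

indicator : Bool → ℤ
indicator true  = + 1
indicator false = + 0

foldr-tabulate : (_∙_ : B → B → B) (ε : B) (h : A → B) {n : ℕ} (g : Fin n → A) →
  L.foldr (λ x r → h x ∙ r) ε (L.tabulate g) ≡ VF.foldr _∙_ ε (h ∘ g)
foldr-tabulate _∙_ ε h {zero} g = refl
foldr-tabulate _∙_ ε h {suc n} g = cong (h (g F.zero) ∙_) (foldr-tabulate _∙_ ε h (g ∘ F.suc))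

Σℤ-allFin : ∀ k (φ : Fin k → ℤ) → Σℤ (L.allFin k) φ ≡ sum φ
Σℤ-allFin k φ = foldr-tabulate _+_ (+ 0) φ (λ i → i)

Πℤ-allFin : ∀ k (φ : Fin k → ℤ) → Πℤ (L.allFin k) φ ≡ Product.sum φ
Πℤ-allFin k φ = foldr-tabulate _*_ (+ 1) φ (λ i → i)

allᵇ-allFin : ∀ k (p : Fin k → Bool) → allᵇ p (L.allFin k) ≡ Conj.sum p
allᵇ-allFin k p = foldr-tabulate _∧_ true p (λ i → i)

Σℤ-cong-∈ : (xs : List A) {f g : A → ℤ} → (∀ {x} → x ∈ xs → f x ≡ g x) → Σℤ xs f ≡ Σℤ xs g
Σℤ-cong-∈ L.[]       e = refl
Σℤ-cong-∈ (x L.∷ xs) e = cong₂ _+_ (e (here refl)) (Σℤ-cong-∈ xs (e ∘ there))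

Σℤ-cong : (xs : List A) {f g : A → ℤ} → (∀ x → f x ≡ g x) → Σℤ xs f ≡ Σℤ xs g
Σℤ-cong xs e = Σℤ-cong-∈ xs (λ {x} _ → e x)

Σℤ-++ : (xs ys : List A) (f : A → ℤ) → Σℤ (xs L.++ ys) f ≡ Σℤ xs f + Σℤ ys f
Σℤ-++ L.[]       ys f = sym (ℤP.+-identityˡ _)
Σℤ-++ (x L.∷ xs) ys f = trans (cong (_+_ (f x)) (Σℤ-++ xs ys f)) (sym (ℤP.+-assoc (f x) _ _))

Σℤ-map : (g : A → B) (xs : List A) (f : B → ℤ) → Σℤ (L.map g xs) f ≡ Σℤ xs (f ∘ g)
Σℤ-map g L.[]       f = refl
Σℤ-map g (x L.∷ xs) f = cong (_+_ (f (g x))) (Σℤ-map g xs f)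

Σℤ-concatMap : (h : A → List B) (xs : List A) (f : B → ℤ) →
  Σℤ (L.concatMap h xs) f ≡ Σℤ xs (λ x → Σℤ (h x) f)
Σℤ-concatMap h L.[]       f = refl
Σℤ-concatMap h (x L.∷ xs) f =
  trans (Σℤ-++ (h x) (L.concatMap h xs) f) (cong (_+_ (Σℤ (h x) f)) (Σℤ-concatMap h xs f))

Σℤ-filterᵇ : (p : A → Bool) (xs : List A) (f : A → ℤ) →
  Σℤ (L.filterᵇ p xs) f ≡ Σℤ xs (λ x → indicator (p x) * f x)
Σℤ-filterᵇ p L.[]       f = refl
Σℤ-filterᵇ p (x L.∷ xs) f with p x
... | true  = cong₂ _+_ (sym (ℤP.*-identityˡ (f x))) (Σℤ-filterᵇ p xs f)
... | false = trans (Σℤ-filterᵇ p xs f) (sym (ℤP.+-identityˡ _))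

Σℤ-zero : (xs : List A) (f : A → ℤ) → (∀ x → f x ≡ + 0) → Σℤ xs f ≡ + 0
Σℤ-zero L.[]       f e = refl
Σℤ-zero (x L.∷ xs) f e = cong₂ _+_ (e x) (Σℤ-zero xs f e)

Σℤ-distrib-+ : (xs : List A) (f g : A → ℤ) → Σℤ xs (λ x → f x + g x) ≡ Σℤ xs f + Σℤ xs g
Σℤ-distrib-+ L.[]       f g = refl
Σℤ-distrib-+ (x L.∷ xs) f g =
  trans (cong (_+_ (f x + g x)) (Σℤ-distrib-+ xs f g)) (middle-swap (f x) (g x) (Σℤ xs f) (Σℤ xs g))
  where
  middle-swap : ∀ a b c d → a + b + (c + d) ≡ a + c + (b + d)
  middle-swap = solve-∀

Σℤ-distrib-- : (xs : List A) (f g : A → ℤ) → Σℤ xs (λ x → f x - g x) ≡ Σℤ xs f - Σℤ xs g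
Σℤ-distrib-- L.[]       f g = refl
Σℤ-distrib-- (x L.∷ xs) f g =
  trans (cong (_+_ (f x - g x)) (Σℤ-distrib-- xs f g)) (middle-swap (f x) (g x) (Σℤ xs f) (Σℤ xs g))
  where
  middle-swap : ∀ a b c d → a - b + (c - d) ≡ a + c - (b + d)
  middle-swap = solve-∀

Σℤ-*ʳ : (xs : List A) (f : A → ℤ) (c : ℤ) → Σℤ xs (λ x → f x * c) ≡ Σℤ xs f * c
Σℤ-*ʳ L.[]       f c = sym (ℤP.*-zeroˡ c)
Σℤ-*ʳ (x L.∷ xs) f c =
  trans (cong (_+_ (f x * c)) (Σℤ-*ʳ xs f c)) (sym (ℤP.*-distribʳ-+ c (f x) (Σℤ xs f)))

Σℤ-∑-comm : (xs : List A) {n : ℕ} (h : Fin n → A → ℤ) →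
  Σℤ xs (λ x → ∑[ i < n ] h i x) ≡ ∑[ i < n ] Σℤ xs (h i)
Σℤ-∑-comm L.[]       {n} h = sym (sum-replicate-zero n)
Σℤ-∑-comm (x L.∷ xs) h =
  trans (cong (_+_ (sum (λ i → h i x))) (Σℤ-∑-comm xs h)) (sym (∑-distrib-+ (λ i → h i x) _))

Σℤ-applyUpTo : ∀ (f : ℕ → ℕ) n (h : ℕ → ℤ) → Σℤ (L.applyUpTo f n) h ≡ Σℤ (L.upTo n) (h ∘ f)
Σℤ-applyUpTo f zero    h = refl
Σℤ-applyUpTo f (suc n) h =
  cong (_+_ (h (f 0))) (trans (Σℤ-applyUpTo (f ∘ suc) n h) (sym (Σℤ-applyUpTo suc n (h ∘ f))))

Σℤ-upTo-last : ∀ n (h : ℕ → ℤ) → Σℤ (L.upTo (suc n)) h ≡ Σℤ (L.upTo n) h + h n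
Σℤ-upTo-last n h = begin
  Σℤ (L.upTo (suc n)) h                ≡⟨ cong (λ xs → Σℤ xs h) (LP.applyUpTo-∷ʳ (λ i → i) n) ⟨
  Σℤ (L.upTo n L.++ L.[ n ]) h         ≡⟨ Σℤ-++ (L.upTo n) L.[ n ] h ⟩
  Σℤ (L.upTo n) h + (h n + + 0)        ≡⟨ cong (_+_ (Σℤ (L.upTo n) h)) (ℤP.+-identityʳ (h n)) ⟩
  Σℤ (L.upTo n) h + h n                ∎
  where open ≡-Reasoning

Σℤ-upTo-telescope : ∀ n (α β : ℕ → ℤ) → α n ≡ + 0 → β 0 ≡ + 0 →
  Σℤ (L.upTo (suc n)) (λ k → α k + β k) ≡ Σℤ (L.upTo n) (λ k → α k + β (suc k))
Σℤ-upTo-telescope n α β αn≡0 β0≡0 = begin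
  Σℤ (L.upTo (suc n)) (λ k → α k + β k)
    ≡⟨ Σℤ-distrib-+ (L.upTo (suc n)) α β ⟩
  Σℤ (L.upTo (suc n)) α + (β 0 + Σℤ (L.applyUpTo suc n) β)
    ≡⟨ cong₂ _+_ (trans (Σℤ-upTo-last n α)
                        (trans (cong (_+_ (Σℤ (L.upTo n) α)) αn≡0) (ℤP.+-identityʳ (Σℤ (L.upTo n) α))))
                 (trans (cong (_+ Σℤ (L.applyUpTo suc n) β) β0≡0) (trans (ℤP.+-identityˡ _) (Σℤ-applyUpTo suc n β))) ⟩
  Σℤ (L.upTo n) α + Σℤ (L.upTo n) (β ∘ suc)
    ≡⟨ Σℤ-distrib-+ (L.upTo n) α (β ∘ suc) ⟨
  Σℤ (L.upTo n) (λ k → α k + β (suc k))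
    ∎
  where open ≡-Reasoning

∑-const : ∀ k (c : ℤ) → ∑[ j < k ] c ≡ + k * c
∑-const zero    c = sym (ℤP.*-zeroˡ c)
∑-const (suc k) c = trans (cong (_+_ c) (∑-const k c)) (suc-* c (+ k))
  where
  suc-* : ∀ c k → c + k * c ≡ (+ 1 + k) * c
  suc-* = solve-∀

ℕSum-lookup : ∀ {k} (v : Vec ℕ k) → ℕSum.sum (V.lookup v) ≡ V.sum v
ℕSum-lookup []      = refl
ℕSum-lookup (x ∷ v) = cong (x ℕ.+_) (ℕSum-lookup v)

-- Blocks of an assignment

δ : ∀ {k} → Fin k → Fin k → ℕ → ℕ
δ i j x = if does (i ≟ j) then x else 0

δ-≡ : ∀ {k} (j : Fin k) x → δ j j x ≡ x
δ-≡ j x = cong (if_then x else 0) (dec-true (j ≟ j) refl)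

δ-≢ : ∀ {k} {i j : Fin k} x → i ≢ j → δ i j x ≡ 0
δ-≢ {i = i} {j} x i≢j = cong (if_then x else 0) (dec-false (i ≟ j) i≢j)

∑-δ : ∀ {k} (i : Fin k) x → ℕSum.sum (λ j → δ i j x) ≡ x
∑-δ {suc k} i x = begin
  ℕSum.sum (λ j → δ i j x)                               ≡⟨ ℕSum.sum-remove {i = i} (λ j → δ i j x) ⟩
  δ i i x ℕ.+ ℕSum.sum {k} (λ j → δ i (punchIn i j) x)   ≡⟨ cong₂ ℕ._+_ (δ-≡ i x)
                                                              (ℕSum.sum-cong-≗ {k} λ j → δ-≢ x (FP.punchInᵢ≢i i j ∘ sym)) ⟩
  x ℕ.+ ℕSum.sum {k} (λ _ → 0)                           ≡⟨ cong (x ℕ.+_) (ℕSum.sum-replicate-zero k) ⟩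
  x ℕ.+ 0                                                ≡⟨ ℕP.+-identityʳ x ⟩
  x                                                      ∎
  where open ≡-Reasoning

δ-punchIn : ∀ {k} (j : Fin (suc k)) (x i : Fin k) y → δ (punchIn j x) (punchIn j i) y ≡ δ x i y
δ-punchIn j x i y with x ≟ i
... | yes refl = δ-≡ (punchIn j x) y
... | no  x≢i  = δ-≢ y (x≢i ∘ FP.punchIn-injective j x i)

blockSum-∷ʳ : (a : Vec ℕ m) (x : ℕ) (f : Vec (Fin k) m) (i j : Fin k) →
  blockSum (a ∷ʳ x) (f ∷ʳ i) j ≡ blockSum a f j ℕ.+ δ i j x
blockSum-∷ʳ [] x [] i j = ℕP.+-identityʳ (δ i j x)
blockSum-∷ʳ (y ∷ a) x (l ∷ f) i j =
  trans (cong (δ l j y ℕ.+_) (blockSum-∷ʳ a x f i j)) (sym (ℕP.+-assoc (δ l j y) _ _))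

blockSum-total : (a : Vec ℕ m) (f : Vec (Fin k) m) → ℕSum.sum (blockSum a f) ≡ V.sum a
blockSum-total {k = k} [] [] = ℕSum.sum-replicate-zero k
blockSum-total (y ∷ a) (i ∷ f) = begin
  ℕSum.sum (λ j → δ i j y ℕ.+ blockSum a f j)                 ≡⟨ ℕSum.∑-distrib-+ (λ j → δ i j y) (blockSum a f) ⟩
  ℕSum.sum (λ j → δ i j y) ℕ.+ ℕSum.sum (blockSum a f)        ≡⟨ cong₂ ℕ._+_ (∑-δ i y) (blockSum-total a f) ⟩
  y ℕ.+ V.sum a                                               ∎
  where open ≡-Reasoning

module _ (j₀ : Fin (suc k)) where

  blockSum-punchIn : (a : Vec ℕ m) (g : Vec (Fin k) m) (i : Fin k) →
    blockSum a (V.map (punchIn j₀) g) (punchIn j₀ i) ≡ blockSum a g i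
  blockSum-punchIn [] [] i = refl
  blockSum-punchIn (y ∷ a) (x ∷ g) i = cong₂ ℕ._+_ (δ-punchIn j₀ x i y) (blockSum-punchIn a g i)

  blockSum-punchIn-self : (a : Vec ℕ m) (g : Vec (Fin k) m) → blockSum a (V.map (punchIn j₀) g) j₀ ≡ 0
  blockSum-punchIn-self [] [] = refl
  blockSum-punchIn-self (y ∷ a) (x ∷ g) =
    cong₂ ℕ._+_ (δ-≢ y (FP.punchInᵢ≢i j₀ x)) (blockSum-punchIn-self a g)

replicate-∷ʳ : ∀ {A : Set} m (x : A) → V.replicate (suc m) x ≡ V.replicate m x ∷ʳ x
replicate-∷ʳ zero    x = refl
replicate-∷ʳ (suc m) x = cong (x ∷_) (replicate-∷ʳ m x)

blockSize≡blockSum-ones : (f : Vec (Fin k) m) (j : Fin k) → blockSize f j ≡ blockSum (V.replicate m 1) f j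
blockSize≡blockSum-ones []      j = refl
blockSize≡blockSum-ones (i ∷ f) j with i ≟ j
... | yes _ = cong suc (blockSize≡blockSum-ones f j)
... | no  _ = blockSize≡blockSum-ones f j

blockSize-zero⇒blockSum-zero : (a : Vec ℕ m) (f : Vec (Fin k) m) (j : Fin k) →
  blockSize f j ≡ 0 → blockSum a f j ≡ 0
blockSize-zero⇒blockSum-zero [] [] j _ = refl
blockSize-zero⇒blockSum-zero (y ∷ a) (i ∷ f) j size≡0 with i ≟ j
... | no _ = blockSize-zero⇒blockSum-zero a f j size≡0

blockSize-∷ : (i : Fin k) (f : Vec (Fin k) m) (j : Fin k) → blockSize (i ∷ f) j ≡ δ i j 1 ℕ.+ blockSize f j
blockSize-∷ i f j = trans (blockSize≡blockSum-ones (i ∷ f) j) (cong (δ i j 1 ℕ.+_) (sym (blockSize≡blockSum-ones f j)))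

blockSize-∷ʳ : (f : Vec (Fin k) m) (i j : Fin k) → blockSize (f ∷ʳ i) j ≡ blockSize f j ℕ.+ δ i j 1
blockSize-∷ʳ {m = m} f i j = begin
  blockSize (f ∷ʳ i) j                           ≡⟨ blockSize≡blockSum-ones (f ∷ʳ i) j ⟩
  blockSum (V.replicate (suc m) 1) (f ∷ʳ i) j    ≡⟨ cong (λ ones → blockSum ones (f ∷ʳ i) j) (replicate-∷ʳ m 1) ⟩
  blockSum (V.replicate m 1 ∷ʳ 1) (f ∷ʳ i) j     ≡⟨ blockSum-∷ʳ (V.replicate m 1) 1 f i j ⟩
  blockSum (V.replicate m 1) f j ℕ.+ δ i j 1     ≡⟨ cong (ℕ._+ δ i j 1) (blockSize≡blockSum-ones f j) ⟨
  blockSize f j ℕ.+ δ i j 1                      ∎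
  where open ≡-Reasoning

module _ (j₀ : Fin (suc k)) (i : Fin k) where

  blockSum-∷ʳ-punchIn : (a : Vec ℕ m) (x : ℕ) (f : Vec (Fin (suc k)) m) →
    blockSum (a ∷ʳ x) (f ∷ʳ j₀) (punchIn j₀ i) ≡ blockSum a f (punchIn j₀ i)
  blockSum-∷ʳ-punchIn a x f = trans (blockSum-∷ʳ a x f j₀ (punchIn j₀ i))
    (trans (cong (blockSum a f (punchIn j₀ i) ℕ.+_) (δ-≢ x (FP.punchInᵢ≢i j₀ i ∘ sym))) (ℕP.+-identityʳ _))

  blockSize-∷ʳ-punchIn : (f : Vec (Fin (suc k)) m) → blockSize (f ∷ʳ j₀) (punchIn j₀ i) ≡ blockSize f (punchIn j₀ i)
  blockSize-∷ʳ-punchIn f = trans (blockSize-∷ʳ f j₀ (punchIn j₀ i))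
    (trans (cong (blockSize f (punchIn j₀ i) ℕ.+_) (δ-≢ 1 (FP.punchInᵢ≢i j₀ i ∘ sym))) (ℕP.+-identityʳ _))

blockSum-∷ʳ-self : (a : Vec ℕ m) (x : ℕ) (f : Vec (Fin k) m) (j : Fin k) →
  blockSum (a ∷ʳ x) (f ∷ʳ j) j ≡ blockSum a f j ℕ.+ x
blockSum-∷ʳ-self a x f j = trans (blockSum-∷ʳ a x f j j) (cong (blockSum a f j ℕ.+_) (δ-≡ j x))

blockSize-∷ʳ-self : (f : Vec (Fin k) m) (j : Fin k) → blockSize (f ∷ʳ j) j ≡ suc (blockSize f j)
blockSize-∷ʳ-self f j =
  trans (blockSize-∷ʳ f j j) (trans (cong (blockSize f j ℕ.+_) (δ-≡ j 1)) (ℕP.+-comm (blockSize f j) 1))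

blockSize-total : (f : Vec (Fin k) m) → ℕSum.sum (blockSize f) ≡ m
blockSize-total {m = m} f = begin
  ℕSum.sum (blockSize f)                          ≡⟨ ℕSum.sum-cong-≗ (blockSize≡blockSum-ones f) ⟩
  ℕSum.sum (blockSum (V.replicate m 1) f)         ≡⟨ blockSum-total (V.replicate m 1) f ⟩
  V.sum (V.replicate m 1)                         ≡⟨ sum-ones m ⟩
  m                                               ∎
  where
  open ≡-Reasoning
  sum-ones : ∀ n → V.sum (V.replicate n 1) ≡ n
  sum-ones zero    = refl
  sum-ones (suc n) = cong suc (sum-ones n)

module _ (j₀ : Fin (suc k)) (g : Vec (Fin k) m) where

  blockSize-punchIn : (i : Fin k) → blockSize (V.map (punchIn j₀) g) (punchIn j₀ i) ≡ blockSize g i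
  blockSize-punchIn i = trans (blockSize≡blockSum-ones (V.map (punchIn j₀) g) (punchIn j₀ i))
    (trans (blockSum-punchIn j₀ (V.replicate m 1) g i) (sym (blockSize≡blockSum-ones g i)))

  blockSize-punchIn-self : blockSize (V.map (punchIn j₀) g) j₀ ≡ 0
  blockSize-punchIn-self = trans (blockSize≡blockSum-ones (V.map (punchIn j₀) g) j₀)
    (blockSum-punchIn-self j₀ (V.replicate m 1) g)

surjective : Vec (Fin k) m → Bool
surjective {k = k} f = Conj.sum (λ j → 1 ≤ᵇ blockSize f j)

othersOccupied : Vec (Fin (suc k)) m → Fin (suc k) → Bool
othersOccupied f j₀ = Conj.sum (λ i → 1 ≤ᵇ blockSize f (punchIn j₀ i))

surjective-remove : (f : Vec (Fin (suc k)) m) (j₀ : Fin (suc k)) →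
  surjective f ≡ (1 ≤ᵇ blockSize f j₀) ∧ othersOccupied f j₀
surjective-remove f j₀ = Conj.sum-remove {i = j₀} (λ j → 1 ≤ᵇ blockSize f j)

surjective-∷ʳ : (f : Vec (Fin (suc k)) m) (j₀ : Fin (suc k)) → surjective (f ∷ʳ j₀) ≡ othersOccupied f j₀
surjective-∷ʳ f j₀ = begin
  surjective (f ∷ʳ j₀)
    ≡⟨ surjective-remove (f ∷ʳ j₀) j₀ ⟩
  (1 ≤ᵇ blockSize (f ∷ʳ j₀) j₀) ∧ othersOccupied (f ∷ʳ j₀) j₀
    ≡⟨ cong₂ _∧_ (cong (1 ≤ᵇ_) (blockSize-∷ʳ-self f j₀))
                 (Conj.sum-cong-≗ λ i → cong (1 ≤ᵇ_) (blockSize-∷ʳ-punchIn j₀ i f)) ⟩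
  othersOccupied f j₀
    ∎
  where open ≡-Reasoning

othersOccupied-punchIn : (g : Vec (Fin k) m) (j₀ : Fin (suc k)) → othersOccupied (V.map (punchIn j₀) g) j₀ ≡ surjective g
othersOccupied-punchIn g j₀ = Conj.sum-cong-≗ λ i → cong (1 ≤ᵇ_) (blockSize-punchIn j₀ g i)

indicator-split : ∀ c b → indicator b ≡ indicator ((1 ≤ᵇ c) ∧ b) + indicator (c ≡ᵇ 0) * indicator b
indicator-split zero    true  = refl
indicator-split zero    false = refl
indicator-split (suc c) true  = refl
indicator-split (suc c) false = refl

-- Sums over assignments and compositions

Σℤ-assignments-∷ : ∀ m k (H : Vec (Fin k) (suc m) → ℤ) →
  Σℤ (assignments (suc m) k) H ≡ ∑[ j < k ] Σℤ (assignments m k) (λ f → H (j ∷ f))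
Σℤ-assignments-∷ m k H =
  trans (Σℤ-concatMap (λ j → L.map (j ∷_) (assignments m k)) (L.allFin k) H)
  (trans (Σℤ-allFin k _)
         (sum-cong-≗ λ j → Σℤ-map (j ∷_) (assignments m k) H))

Σℤ-assignments-∷ʳ : ∀ m k (H : Vec (Fin k) (suc m) → ℤ) →
  Σℤ (assignments (suc m) k) H ≡ Σℤ (assignments m k) (λ f → ∑[ j < k ] H (f ∷ʳ j))
Σℤ-assignments-∷ʳ zero    k H =
  trans (Σℤ-assignments-∷ zero k H)
        (trans (sum-cong-≗ λ j → ℤP.+-identityʳ (H (j ∷ []))) (sym (ℤP.+-identityʳ _)))
Σℤ-assignments-∷ʳ (suc m) k H =
  trans (Σℤ-assignments-∷ (suc m) k H)
  (trans (sum-cong-≗ λ j → Σℤ-assignments-∷ʳ m k (λ f → H (j ∷ f)))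
         (sym (Σℤ-assignments-∷ m k (λ f → ∑[ j < k ] H (f ∷ʳ j)))))

Σℤ-assignments-avoiding : ∀ m k (j₀ : Fin (suc k)) (H : Vec (Fin (suc k)) m → ℤ) →
  Σℤ (assignments m (suc k)) (λ f → indicator (blockSize f j₀ ≡ᵇ 0) * H f)
    ≡ Σℤ (assignments m k) (λ g → H (V.map (punchIn j₀) g))
Σℤ-assignments-avoiding zero    k j₀ H = cong (_+ + 0) (ℤP.*-identityˡ (H []))
Σℤ-assignments-avoiding (suc m) k j₀ H = begin
  Σℤ (assignments (suc m) (suc k)) (λ f → χ f * H f)
    ≡⟨ Σℤ-assignments-∷ m (suc k) (λ f → χ f * H f) ⟩
  ∑[ j < suc k ] Σℤ (assignments m (suc k)) (λ f → χ (j ∷ f) * H (j ∷ f))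
    ≡⟨ sum-remove {i = j₀} (λ j → Σℤ (assignments m (suc k)) (λ f → χ (j ∷ f) * H (j ∷ f))) ⟩
  Σℤ (assignments m (suc k)) (λ f → χ (j₀ ∷ f) * H (j₀ ∷ f))
    + ∑[ i < k ] Σℤ (assignments m (suc k)) (λ f → χ (punchIn j₀ i ∷ f) * H (punchIn j₀ i ∷ f))
    ≡⟨ cong₂ _+_ (Σℤ-zero (assignments m (suc k)) _ occupied) (sum-cong-≗ unoccupied) ⟩
  + 0 + ∑[ i < k ] Σℤ (assignments m k) (λ g → H (punchIn j₀ i ∷ V.map (punchIn j₀) g))
    ≡⟨ ℤP.+-identityˡ _ ⟩
  ∑[ i < k ] Σℤ (assignments m k) (λ g → H (V.map (punchIn j₀) (i ∷ g)))
    ≡⟨ Σℤ-assignments-∷ m k (λ g → H (V.map (punchIn j₀) g)) ⟨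
  Σℤ (assignments (suc m) k) (λ g → H (V.map (punchIn j₀) g))
    ∎
  where
  open ≡-Reasoning
  χ : ∀ {n} → Vec (Fin (suc k)) n → ℤ
  χ f = indicator (blockSize f j₀ ≡ᵇ 0)
  occupied : ∀ f → χ (j₀ ∷ f) * H (j₀ ∷ f) ≡ + 0
  occupied f = trans (cong (λ c → indicator (c ≡ᵇ 0) * H (j₀ ∷ f))
                      (trans (blockSize-∷ j₀ f j₀) (cong (ℕ._+ blockSize f j₀) (δ-≡ j₀ 1))))
                     (ℤP.*-zeroˡ (H (j₀ ∷ f)))
  unoccupied : ∀ i → Σℤ (assignments m (suc k)) (λ f → χ (punchIn j₀ i ∷ f) * H (punchIn j₀ i ∷ f))
                   ≡ Σℤ (assignments m k) (λ g → H (punchIn j₀ i ∷ V.map (punchIn j₀) g))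
  unoccupied i =
    trans (Σℤ-cong (assignments m (suc k)) λ f →
             cong (λ c → indicator (c ≡ᵇ 0) * H (punchIn j₀ i ∷ f))
                  (trans (blockSize-∷ (punchIn j₀ i) f j₀) (cong (ℕ._+ blockSize f j₀) (δ-≢ 1 (FP.punchInᵢ≢i j₀ i)))))
          (Σℤ-assignments-avoiding m k j₀ (λ f → H (punchIn j₀ i ∷ f)))

Σℤ-compositions-∷ : ∀ k N (H : Vec ℕ (suc k) → ℤ) →
  Σℤ (compositions (suc k) N) H ≡ Σℤ (L.upTo (suc N)) (λ e → Σℤ (compositions k (N ∸ e)) (λ v → H (e ∷ v)))
Σℤ-compositions-∷ k N H =
  trans (Σℤ-concatMap (λ e → L.map (e ∷_) (compositions k (N ∸ e))) (L.upTo (suc N)) H)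
        (Σℤ-cong (L.upTo (suc N)) λ e → Σℤ-map (e ∷_) (compositions k (N ∸ e)) H)

Σℤ-compositions-zero : ∀ k (H : Vec ℕ k → ℤ) → Σℤ (compositions k 0) H ≡ H (V.replicate k 0)
Σℤ-compositions-zero zero    H = ℤP.+-identityʳ (H [])
Σℤ-compositions-zero (suc k) H =
  trans (Σℤ-compositions-∷ k 0 H) (trans (ℤP.+-identityʳ _) (Σℤ-compositions-zero k (λ v → H (0 ∷ v))))

∈-compositions⇒sum : ∀ k N {d : Vec ℕ k} → d ∈ compositions k N → V.sum d ≡ N
∈-compositions⇒sum zero    zero    (here refl) = refl
∈-compositions⇒sum (suc k) N       d∈
  with e , e∈ , d∈′ ← find (∈-concatMap⁻ (λ e → L.map (e ∷_) (compositions k (N ∸ e))) {xs = L.upTo (suc N)} d∈)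
  with v , v∈ , refl ← ∈-map⁻ (e ∷_) d∈′
  = trans (cong (e ℕ.+_) (∈-compositions⇒sum k (N ∸ e) v∈)) (ℕP.m+[n∸m]≡n (ℕP.<⇒≤pred (∈-upTo⁻ e∈)))

lookup-removeAt : ∀ {k} (d : Vec ℕ (suc k)) (j₀ : Fin (suc k)) (i : Fin k) →
  V.lookup (V.removeAt d j₀) i ≡ V.lookup d (punchIn j₀ i)
lookup-removeAt (x ∷ d)     F.zero     i          = refl
lookup-removeAt (x ∷ y ∷ d) (F.suc j₀) F.zero     = refl
lookup-removeAt (x ∷ y ∷ d) (F.suc j₀) (F.suc i)  = lookup-removeAt (y ∷ d) j₀ i

removeAt-suc : ∀ {k} (x : ℕ) (d : Vec ℕ (suc k)) (j₀ : Fin (suc k)) →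
  V.removeAt (x ∷ d) (F.suc j₀) ≡ x ∷ V.removeAt d j₀
removeAt-suc x (y ∷ d) j₀ = refl

Σℤ-compositions-zero-at : ∀ k (j₀ : Fin (suc k)) N (H : Vec ℕ k → ℤ) →
  Σℤ (compositions (suc k) N) (λ d → indicator (V.lookup d j₀ ≡ᵇ 0) * H (V.removeAt d j₀))
    ≡ Σℤ (compositions k N) H
Σℤ-compositions-zero-at k F.zero N H =
  trans (Σℤ-compositions-∷ k N G)
  (trans (cong₂ _+_ (Σℤ-cong (compositions k N) λ v → ℤP.*-identityˡ (H v))
                    (trans (Σℤ-applyUpTo suc N φ) (Σℤ-zero (L.upTo N) (φ ∘ suc) λ e →
                       Σℤ-zero (compositions k (N ∸ suc e)) _ λ v → ℤP.*-zeroˡ (H v))))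
         (ℤP.+-identityʳ _))
  where
  G : Vec ℕ (suc k) → ℤ
  G d = indicator (V.lookup d F.zero ≡ᵇ 0) * H (V.removeAt d F.zero)
  φ : ℕ → ℤ
  φ e = Σℤ (compositions k (N ∸ e)) (λ v → G (e ∷ v))
Σℤ-compositions-zero-at (suc k) (F.suc j₀) N H =
  trans (Σℤ-compositions-∷ (suc k) N G)
  (trans (Σℤ-cong (L.upTo (suc N)) λ e →
            trans (Σℤ-cong (compositions (suc k) (N ∸ e)) λ w →
                     cong (λ u → indicator (V.lookup w j₀ ≡ᵇ 0) * H u) (removeAt-suc e w j₀))
                  (Σℤ-compositions-zero-at k j₀ (N ∸ e) (λ u → H (e ∷ u))))
         (sym (Σℤ-compositions-∷ k N H)))
  where
  G : Vec ℕ (suc (suc k)) → ℤ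
  G d = indicator (V.lookup d (F.suc j₀) ≡ᵇ 0) * H (V.removeAt d (F.suc j₀))

Σℤ-compositions-shift : ∀ k (j₀ : Fin (suc k)) N (H : Vec ℕ k → ℕ → ℤ) → (∀ v → H v 0 ≡ + 0) →
  Σℤ (compositions (suc k) (suc N)) (λ d → H (V.removeAt d j₀) (V.lookup d j₀))
    ≡ Σℤ (compositions (suc k) N) (λ d → H (V.removeAt d j₀) (suc (V.lookup d j₀)))
Σℤ-compositions-shift k F.zero N H H0 =
  trans (Σℤ-compositions-∷ k (suc N) (λ d → H (V.removeAt d F.zero) (V.lookup d F.zero)))
  (trans (cong₂ _+_ (Σℤ-zero (compositions k (suc N)) (λ v → H v 0) H0)
                    (Σℤ-applyUpTo suc (suc N) (λ e → Σℤ (compositions k (suc N ∸ e)) (λ v → H v e))))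
  (trans (ℤP.+-identityˡ _)
         (sym (Σℤ-compositions-∷ k N (λ d → H (V.removeAt d F.zero) (suc (V.lookup d F.zero)))))))
Σℤ-compositions-shift (suc k) (F.suc j₀) N H H0 = begin
  Σℤ (compositions (suc (suc k)) (suc N)) G
    ≡⟨ Σℤ-compositions-∷ (suc k) (suc N) G ⟩
  Σℤ (L.upTo (suc (suc N))) φ
    ≡⟨ Σℤ-upTo-last (suc N) φ ⟩
  Σℤ (L.upTo (suc N)) φ + φ (suc N)
    ≡⟨ cong (_+_ (Σℤ (L.upTo (suc N)) φ)) last-vanishes ⟩
  Σℤ (L.upTo (suc N)) φ + + 0
    ≡⟨ ℤP.+-identityʳ _ ⟩
  Σℤ (L.upTo (suc N)) φ
    ≡⟨ Σℤ-cong-∈ (L.upTo (suc N)) (λ e∈ → shifted (ℕP.<⇒≤pred (∈-upTo⁻ e∈))) ⟩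
  Σℤ (L.upTo (suc N)) (λ e → Σℤ (compositions (suc k) (N ∸ e)) (λ w → G′ (e ∷ w)))
    ≡⟨ Σℤ-compositions-∷ (suc k) N G′ ⟨
  Σℤ (compositions (suc (suc k)) N) G′
    ∎
  where
  open ≡-Reasoning
  G G′ : Vec ℕ (suc (suc k)) → ℤ
  G  d = H (V.removeAt d (F.suc j₀)) (V.lookup d (F.suc j₀))
  G′ d = H (V.removeAt d (F.suc j₀)) (suc (V.lookup d (F.suc j₀)))
  φ : ℕ → ℤ
  φ e = Σℤ (compositions (suc k) (suc N ∸ e)) (λ w → G (e ∷ w))
  last-vanishes : φ (suc N) ≡ + 0
  last-vanishes =
    trans (cong (λ M → Σℤ (compositions (suc k) M) (λ w → G (suc N ∷ w))) (ℕP.n∸n≡0 N))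
    (trans (Σℤ-compositions-zero (suc k) (λ w → G (suc N ∷ w)))
    (trans (cong₂ H (removeAt-suc (suc N) (V.replicate (suc k) 0) j₀) (VP.lookup-replicate j₀ 0))
           (H0 _)))
  shifted : ∀ {e} → e ℕ.≤ N → φ e ≡ Σℤ (compositions (suc k) (N ∸ e)) (λ w → G′ (e ∷ w))
  shifted {e} e≤N =
    trans (cong (λ M → Σℤ (compositions (suc k) M) (λ w → G (e ∷ w))) (ℕP.+-∸-assoc 1 e≤N))
    (trans (Σℤ-cong (compositions (suc k) (suc (N ∸ e))) λ w → cong (λ u → H u (V.lookup w j₀)) (removeAt-suc e w j₀))
    (trans (Σℤ-compositions-shift k j₀ (N ∸ e) (λ u → H (e ∷ u)) (λ u → H0 (e ∷ u)))
           (Σℤ-cong (compositions (suc k) (N ∸ e)) λ w →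
              cong (λ u → H u (suc (V.lookup w j₀))) (sym (removeAt-suc e w j₀)))))

-- Block weights

C-absorption : ∀ n k → + suc k * + (n C suc k) ≡ (+ n - + k) * + (n C k)
C-absorption zero    zero    = refl
C-absorption zero    (suc k) = trans (ℤP.*-zeroʳ (+ suc (suc k))) (sym (ℤP.*-zeroʳ (+ 0 - + suc k)))
C-absorption (suc n) zero    =
  trans (ℤP.*-identityˡ _)
        (trans (cong +_ (nC1≡n (suc n))) (sym (trans (ℤP.*-identityʳ (+ suc n - + 0)) (ℤP.+-identityʳ (+ suc n)))))
C-absorption (suc n) (suc k) = begin
  + suc (suc k) * + (suc n C suc (suc k))
    ≡⟨ cong (λ c → + suc (suc k) * + c) (nCk+nC[k+1]≡[n+1]C[k+1] n (suc k)) ⟨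
  + suc (suc k) * (+ y + + z)
    ≡⟨ pascal-step (+ k) (+ n) (+ x) (+ y) (+ z) (C-absorption n (suc k)) (C-absorption n k) ⟩
  (+ suc n - + suc k) * (+ x + + y)
    ≡⟨ cong (λ c → (+ suc n - + suc k) * + c) (nCk+nC[k+1]≡[n+1]C[k+1] n k) ⟩
  (+ suc n - + suc k) * + (suc n C suc k)
    ∎
  where
  open ≡-Reasoning
  x = n C k
  y = n C suc k
  z = n C suc (suc k)
  pascal-step : ∀ (K N x y z : ℤ) →
    (+ 2 + K) * z ≡ (N - (+ 1 + K)) * y → (+ 1 + K) * y ≡ (N - K) * x →
    (+ 2 + K) * (y + z) ≡ (+ 1 + N - (+ 1 + K)) * (x + y)
  pascal-step K N x y z hz hy = begin
    (+ 2 + K) * (y + z)                      ≡⟨ ℤP.*-distribˡ-+ (+ 2 + K) y z ⟩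
    (+ 2 + K) * y + (+ 2 + K) * z            ≡⟨ cong (_+_ ((+ 2 + K) * y)) hz ⟩
    (+ 2 + K) * y + (N - (+ 1 + K)) * y      ≡⟨ collect K N y ⟩
    (+ 1 + K) * y + (N - K) * y              ≡⟨ cong (_+ (N - K) * y) hy ⟩
    (N - K) * x + (N - K) * y                ≡⟨ factor K N x y ⟩
    (+ 1 + N - (+ 1 + K)) * (x + y)          ∎
    where
    collect : ∀ K N y → (+ 2 + K) * y + (N - (+ 1 + K)) * y ≡ (+ 1 + K) * y + (N - K) * y
    collect = solve-∀
    factor : ∀ K N x y → (N - K) * x + (N - K) * y ≡ (+ 1 + N - (+ 1 + K)) * (x + y)
    factor = solve-∀

pos-2*+1 : ∀ n → + (2 ℕ.* n ℕ.+ 1) ≡ + 2 * + n + + 1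
pos-2*+1 n = trans (ℤP.pos-+ (2 ℕ.* n) 1) (cong (_+ + 1) (ℤP.pos-* 2 n))

oddFactor-suc : ∀ d i → + (2 ℕ.* suc d ℕ.+ 1) - + (2 ℕ.* suc i) ≡ + (2 ℕ.* d ℕ.+ 1) - + (2 ℕ.* i)
oddFactor-suc d i =
  trans (cong₂ (λ x y → + (x ℕ.+ 1) - + y) (ℕP.*-suc 2 d) (ℕP.*-suc 2 i))
  (trans (cong₂ _-_ (ℤP.pos-+ 2 (2 ℕ.* d ℕ.+ 1)) (ℤP.pos-+ 2 (2 ℕ.* i)))
         (cancel (+ (2 ℕ.* d ℕ.+ 1)) (+ (2 ℕ.* i))))
  where
  cancel : ∀ x y → + 2 + x - (+ 2 + y) ≡ x - y
  cancel = solve-∀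

oddProd-suc : ∀ e r → oddProd (suc e) (suc r) ≡ + (2 ℕ.* e ℕ.+ 1) * oddProd e r
oddProd-suc e zero = begin
  + 1 * (+ (2 ℕ.* suc e ℕ.+ 1) - + (2 ℕ.* 1))   ≡⟨ ℤP.*-identityˡ _ ⟩
  + (2 ℕ.* suc e ℕ.+ 1) - + (2 ℕ.* 1)           ≡⟨ oddFactor-suc e 0 ⟩
  + (2 ℕ.* e ℕ.+ 1) - + 0                       ≡⟨ trans (ℤP.+-identityʳ o) (sym (ℤP.*-identityʳ o)) ⟩
  + (2 ℕ.* e ℕ.+ 1) * + 1                       ∎
  where
  open ≡-Reasoning
  o = + (2 ℕ.* e ℕ.+ 1)
oddProd-suc e (suc r) = begin
  oddProd (suc e) (suc r) * (+ (2 ℕ.* suc e ℕ.+ 1) - + (2 ℕ.* suc (suc r)))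
    ≡⟨ cong₂ _*_ (oddProd-suc e r) (oddFactor-suc e (suc r)) ⟩
  + (2 ℕ.* e ℕ.+ 1) * oddProd e r * (+ (2 ℕ.* e ℕ.+ 1) - + (2 ℕ.* suc r))
    ≡⟨ ℤP.*-assoc (+ (2 ℕ.* e ℕ.+ 1)) (oddProd e r) _ ⟩
  + (2 ℕ.* e ℕ.+ 1) * oddProd e (suc r)
    ∎
  where open ≡-Reasoning

C-pascal² : ∀ n k → suc (suc n) C suc (suc k) ≡ n C k ℕ.+ n C suc k ℕ.+ (n C suc k ℕ.+ n C suc (suc k))
C-pascal² n k =
  trans (sym (nCk+nC[k+1]≡[n+1]C[k+1] (suc n) (suc k)))
        (cong₂ ℕ._+_ (sym (nCk+nC[k+1]≡[n+1]C[k+1] n k)) (sym (nCk+nC[k+1]≡[n+1]C[k+1] n (suc k))))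

-- B(s, d, r) = binom(2s+1, 2d) ∏_{i=1}^{r-1} (2d+1-2i), the factor of a block I with a_[I] = s, |I| = r.
blockWeight : ℕ → ℕ → ℕ → ℤ
blockWeight s d r = + ((2 ℕ.* s ℕ.+ 1) C (2 ℕ.* d)) * oddProd d (r ∸ 1)

stepFactor : ℕ → ℕ → ℤ
stepFactor s e = + 4 * + s - + 2 * + e + + 3

blockWeight-step-occupied : ∀ s e r →
  blockWeight (suc s) (suc e) (suc (suc r)) - blockWeight s (suc e) (suc (suc r))
    ≡ blockWeight s e (suc r) * stepFactor s e
blockWeight-step-occupied s e r = begin
  + ((2 ℕ.* suc s ℕ.+ 1) C (2 ℕ.* suc e)) * O′ - + (n C (2 ℕ.* suc e)) * O′
    ≡⟨ cong₂ (λ c c′ → + c * O′ - + c′ * O′)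
             (trans (cong₂ (λ a b → (a ℕ.+ 1) C b) (ℕP.*-suc 2 s) (ℕP.*-suc 2 e)) (C-pascal² n ℓ))
             (cong (n C_) (ℕP.*-suc 2 e)) ⟩
  + (x ℕ.+ y ℕ.+ (y ℕ.+ z)) * O′ - + z * O′
    ≡⟨ cong₂ (λ c o → c * o - + z * o)
             (trans (ℤP.pos-+ (x ℕ.+ y) (y ℕ.+ z)) (cong₂ _+_ (ℤP.pos-+ x y) (ℤP.pos-+ y z)))
             (trans (oddProd-suc e r) (cong (_* O) (pos-2*+1 e))) ⟩
  (+ x + + y + (+ y + + z)) * ((+ 2 * + e + + 1) * O) - + z * ((+ 2 * + e + + 1) * O)
    ≡⟨ combine (+ s) (+ e) (+ x) (+ y) (+ z) O absorption ⟩
  + x * O * stepFactor s e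
    ∎
  where
  open ≡-Reasoning
  n = 2 ℕ.* s ℕ.+ 1
  ℓ = 2 ℕ.* e
  x = n C ℓ
  y = n C suc ℓ
  z = n C suc (suc ℓ)
  O = oddProd e r
  O′ = oddProd (suc e) (suc r)
  absorption : (+ 1 + + 2 * + e) * + y ≡ (+ 2 * + s + + 1 - + 2 * + e) * + x
  absorption = subst₂ (λ K N → (+ 1 + K) * + y ≡ (N - K) * + x) (ℤP.pos-* 2 e) (pos-2*+1 s) (C-absorption n ℓ)
  combine : ∀ S E x y z O → (+ 1 + + 2 * E) * y ≡ (+ 2 * S + + 1 - + 2 * E) * x →
    (x + y + (y + z)) * ((+ 2 * E + + 1) * O) - z * ((+ 2 * E + + 1) * O) ≡ x * O * (+ 4 * S - + 2 * E + + 3)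
  combine S E x y z O hy = begin
    (x + y + (y + z)) * ((+ 2 * E + + 1) * O) - z * ((+ 2 * E + + 1) * O)
      ≡⟨ expand S E x y z O ⟩
    (x * (+ 2 * E + + 1) + + 2 * ((+ 1 + + 2 * E) * y)) * O
      ≡⟨ cong (λ t → (x * (+ 2 * E + + 1) + + 2 * t) * O) hy ⟩
    (x * (+ 2 * E + + 1) + + 2 * ((+ 2 * S + + 1 - + 2 * E) * x)) * O
      ≡⟨ collect S E x O ⟩
    x * O * (+ 4 * S - + 2 * E + + 3)
      ∎
    where
    expand : ∀ S E x y z O → (x + y + (y + z)) * ((+ 2 * E + + 1) * O) - z * ((+ 2 * E + + 1) * O)
                           ≡ (x * (+ 2 * E + + 1) + + 2 * ((+ 1 + + 2 * E) * y)) * O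
    expand = solve-∀
    collect : ∀ S E x O → (x * (+ 2 * E + + 1) + + 2 * ((+ 2 * S + + 1 - + 2 * E) * x)) * O
                        ≡ x * O * (+ 4 * S - + 2 * E + + 3)
    collect = solve-∀

1<2*suc : ∀ e → 1 < 2 ℕ.* suc e
1<2*suc e = subst (1 <_) (sym (ℕP.*-suc 2 e)) (s≤s (s≤s z≤n))

3<2*suc² : ∀ e → 3 < 2 ℕ.* suc (suc e)
3<2*suc² e = subst (3 <_) (sym (trans (ℕP.*-suc 2 (suc e)) (cong (2 ℕ.+_) (ℕP.*-suc 2 e))))
                   (s≤s (s≤s (s≤s (s≤s z≤n))))

blockWeight-empty : ∀ e → blockWeight 0 e 0 ≡ indicator (e ≡ᵇ 0)
blockWeight-empty zero    = refl
blockWeight-empty (suc e) rewrite k>n⇒nCk≡0 (1<2*suc e) = refl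

-- For r = 0 the truncated r ∸ 1 in blockWeight makes the identity fail unless s = 0.
blockWeight-step : ∀ s e r → (r ≡ 0 → s ≡ 0) →
  blockWeight (suc s) (suc e) (suc r) - blockWeight s (suc e) (suc r) ≡ blockWeight s e r * stepFactor s e
blockWeight-step s e (suc r) _ = blockWeight-step-occupied s e r
blockWeight-step s e zero empty with refl ← empty refl = empty-block e
  where
  empty-block : ∀ e → blockWeight 1 (suc e) 1 - blockWeight 0 (suc e) 1 ≡ blockWeight 0 e 0 * stepFactor 0 e
  empty-block zero = refl
  empty-block (suc e) rewrite k>n⇒nCk≡0 (3<2*suc² e) | k>n⇒nCk≡0 (1<2*suc (suc e)) | k>n⇒nCk≡0 (1<2*suc e) = refl

∑-stepFactor : ∀ {k} (σ ε : Fin k → ℕ) →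
  ∑[ j < k ] stepFactor (σ j) (ε j) ≡ + 4 * + ℕSum.sum σ - + 2 * + ℕSum.sum ε + + k * + 3
∑-stepFactor {zero}  σ ε = refl
∑-stepFactor {suc k} σ ε = begin
  stepFactor (σ F.zero) (ε F.zero) + ∑[ j < k ] stepFactor (σ (F.suc j)) (ε (F.suc j))
    ≡⟨ cong (_+_ (stepFactor (σ F.zero) (ε F.zero))) (∑-stepFactor (σ ∘ F.suc) (ε ∘ F.suc)) ⟩
  stepFactor (σ F.zero) (ε F.zero) + (+ 4 * + ℕSum.sum (σ ∘ F.suc) - + 2 * + ℕSum.sum (ε ∘ F.suc) + + k * + 3)
    ≡⟨ collect (+ σ F.zero) (+ ε F.zero) (+ ℕSum.sum (σ ∘ F.suc)) (+ ℕSum.sum (ε ∘ F.suc)) (+ k) ⟩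
  + 4 * (+ σ F.zero + + ℕSum.sum (σ ∘ F.suc)) - + 2 * (+ ε F.zero + + ℕSum.sum (ε ∘ F.suc)) + + suc k * + 3
    ∎
  where
  open ≡-Reasoning
  collect : ∀ a b c d n → + 4 * a - + 2 * b + + 3 + (+ 4 * c - + 2 * d + n * + 3)
                        ≡ + 4 * (a + c) - + 2 * (b + d) + (+ 1 + n) * + 3
  collect = solve-∀

-- Partition weights and partition sums

blockWeights : Vec ℕ m → Vec (Fin k) m → Vec ℕ k → Fin k → ℤ
blockWeights a f d j = blockWeight (blockSum a f j) (V.lookup d j) (blockSize f j)

partitionWeight : Vec ℕ m → Vec (Fin k) m → ℕ → ℤ
partitionWeight {k = k} a f N = Σℤ (compositions k N) (λ d → Πℤ (L.allFin k) (blockWeights a f d))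

module _ (a : Vec ℕ m) (f : Vec (Fin (suc k)) m) (j₀ : Fin (suc k)) where

  private
    s = blockSum a f j₀
    r = blockSize f j₀

  otherBlockWeights : Vec ℕ k → ℤ
  otherBlockWeights v =
    Product.sum (λ i → blockWeight (blockSum a f (punchIn j₀ i)) (V.lookup v i) (blockSize f (punchIn j₀ i)))

  blockWeights-remove : ∀ d → Πℤ (L.allFin (suc k)) (blockWeights a f d)
    ≡ blockWeight s (V.lookup d j₀) r * otherBlockWeights (V.removeAt d j₀)
  blockWeights-remove d =
    trans (Πℤ-allFin (suc k) (blockWeights a f d))
    (trans (Product.sum-remove {i = j₀} (blockWeights a f d))
           (cong (_*_ (blockWeight s (V.lookup d j₀) r)) (Product.sum-cong-≗ λ i →
              cong (λ e → blockWeight (blockSum a f (punchIn j₀ i)) e (blockSize f (punchIn j₀ i)))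
                   (sym (lookup-removeAt d j₀ i)))))

  blockWeights-∷ʳ-remove : ∀ x d → Πℤ (L.allFin (suc k)) (blockWeights (a ∷ʳ x) (f ∷ʳ j₀) d)
    ≡ blockWeight (s ℕ.+ x) (V.lookup d j₀) (suc r) * otherBlockWeights (V.removeAt d j₀)
  blockWeights-∷ʳ-remove x d =
    trans (Πℤ-allFin (suc k) (blockWeights (a ∷ʳ x) (f ∷ʳ j₀) d))
    (trans (Product.sum-remove {i = j₀} (blockWeights (a ∷ʳ x) (f ∷ʳ j₀) d))
           (cong₂ _*_ (cong₂ (λ s′ r′ → blockWeight s′ (V.lookup d j₀) r′)
                             (blockSum-∷ʳ-self a x f j₀) (blockSize-∷ʳ-self f j₀))
                      (Product.sum-cong-≗ λ i →
                         cong₃ blockWeight (blockSum-∷ʳ-punchIn j₀ i a x f) (sym (lookup-removeAt d j₀ i))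
                                           (blockSize-∷ʳ-punchIn j₀ i f))))

  partitionWeight-∷ʳ-difference : ∀ N →
    partitionWeight (a ∷ʳ 1) (f ∷ʳ j₀) (suc N) - partitionWeight (a ∷ʳ 0) (f ∷ʳ j₀) (suc N)
      ≡ Σℤ (compositions (suc k) N) (λ d → Πℤ (L.allFin (suc k)) (blockWeights a f d) * stepFactor s (V.lookup d j₀))
  partitionWeight-∷ʳ-difference N = begin
    partitionWeight (a ∷ʳ 1) (f ∷ʳ j₀) (suc N) - partitionWeight (a ∷ʳ 0) (f ∷ʳ j₀) (suc N)
      ≡⟨ Σℤ-distrib-- (compositions (suc k) (suc N)) (Π 1) (Π 0) ⟨
    Σℤ (compositions (suc k) (suc N)) (λ d → Π 1 d - Π 0 d)
      ≡⟨ Σℤ-cong (compositions (suc k) (suc N)) (λ d →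
           trans (cong₂ _-_ (blockWeights-∷ʳ-remove 1 d) (blockWeights-∷ʳ-remove 0 d))
                 (sym (*-distribʳ-- (otherBlockWeights (V.removeAt d j₀))
                        (blockWeight (s ℕ.+ 1) (V.lookup d j₀) (suc r)) (blockWeight (s ℕ.+ 0) (V.lookup d j₀) (suc r))))) ⟩
    Σℤ (compositions (suc k) (suc N)) (λ d → H (V.removeAt d j₀) (V.lookup d j₀))
      ≡⟨ Σℤ-compositions-shift k j₀ N H H-zero ⟩
    Σℤ (compositions (suc k) N) (λ d → H (V.removeAt d j₀) (suc (V.lookup d j₀)))
      ≡⟨ Σℤ-cong (compositions (suc k) N) step ⟩
    Σℤ (compositions (suc k) N) (λ d → Πℤ (L.allFin (suc k)) (blockWeights a f d) * stepFactor s (V.lookup d j₀))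
      ∎
    where
    open ≡-Reasoning
    Π : ℕ → Vec ℕ (suc k) → ℤ
    Π x d = Πℤ (L.allFin (suc k)) (blockWeights (a ∷ʳ x) (f ∷ʳ j₀) d)
    H : Vec ℕ k → ℕ → ℤ
    H v e = (blockWeight (s ℕ.+ 1) e (suc r) - blockWeight (s ℕ.+ 0) e (suc r)) * otherBlockWeights v
    -- Both weights have the factor binom(_, 0), which reduces to 1.
    H-zero : ∀ v → H v 0 ≡ + 0
    H-zero v = trans (cong (_* otherBlockWeights v) (ℤP.+-inverseʳ (blockWeight (s ℕ.+ 1) 0 (suc r))))
                     (ℤP.*-zeroˡ (otherBlockWeights v))
    step : ∀ d → H (V.removeAt d j₀) (suc (V.lookup d j₀))
               ≡ Πℤ (L.allFin (suc k)) (blockWeights a f d) * stepFactor s (V.lookup d j₀)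
    step d = begin
      (blockWeight (s ℕ.+ 1) (suc e) (suc r) - blockWeight (s ℕ.+ 0) (suc e) (suc r)) * R
        ≡⟨ cong₂ (λ s₁ s₀ → (blockWeight s₁ (suc e) (suc r) - blockWeight s₀ (suc e) (suc r)) * R)
                 (ℕP.+-comm s 1) (ℕP.+-identityʳ s) ⟩
      (blockWeight (suc s) (suc e) (suc r) - blockWeight s (suc e) (suc r)) * R
        ≡⟨ cong (_* R) (blockWeight-step s e r (blockSize-zero⇒blockSum-zero a f j₀)) ⟩
      blockWeight s e r * stepFactor s e * R
        ≡⟨ swap-last (blockWeight s e r) (stepFactor s e) R ⟩
      blockWeight s e r * R * stepFactor s e
        ≡⟨ cong (_* stepFactor s e) (blockWeights-remove d) ⟨
      Πℤ (L.allFin (suc k)) (blockWeights a f d) * stepFactor s e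
        ∎
      where
      e = V.lookup d j₀
      R = otherBlockWeights (V.removeAt d j₀)
      swap-last : ∀ x y z → x * y * z ≡ x * z * y
      swap-last = solve-∀

partitionWeight-∷ʳ-difference-total : (a : Vec ℕ m) (f : Vec (Fin (suc k)) m) (N : ℕ) →
  ∑[ j₀ < suc k ] (partitionWeight (a ∷ʳ 1) (f ∷ʳ j₀) (suc N) - partitionWeight (a ∷ʳ 0) (f ∷ʳ j₀) (suc N))
    ≡ partitionWeight a f N * (+ 4 * + V.sum a - + 2 * + N + + suc k * + 3)
partitionWeight-∷ʳ-difference-total {k = k} a f N = begin
  ∑[ j₀ < suc k ] (partitionWeight (a ∷ʳ 1) (f ∷ʳ j₀) (suc N) - partitionWeight (a ∷ʳ 0) (f ∷ʳ j₀) (suc N))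
    ≡⟨ sum-cong-≗ (λ j₀ → partitionWeight-∷ʳ-difference a f j₀ N) ⟩
  ∑[ j₀ < suc k ] Σℤ (compositions (suc k) N) (λ d → Π d * stepFactor (blockSum a f j₀) (V.lookup d j₀))
    ≡⟨ Σℤ-∑-comm (compositions (suc k) N) (λ j₀ d → Π d * stepFactor (blockSum a f j₀) (V.lookup d j₀)) ⟨
  Σℤ (compositions (suc k) N) (λ d → ∑[ j₀ < suc k ] (Π d * stepFactor (blockSum a f j₀) (V.lookup d j₀)))
    ≡⟨ Σℤ-cong-∈ (compositions (suc k) N) factor-out ⟩
  Σℤ (compositions (suc k) N) (λ d → Π d * (+ 4 * + V.sum a - + 2 * + N + + suc k * + 3))
    ≡⟨ Σℤ-*ʳ (compositions (suc k) N) Π _ ⟩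
  partitionWeight a f N * (+ 4 * + V.sum a - + 2 * + N + + suc k * + 3)
    ∎
  where
  open ≡-Reasoning
  Π : Vec ℕ (suc k) → ℤ
  Π d = Πℤ (L.allFin (suc k)) (blockWeights a f d)
  factor-out : ∀ {d} → d ∈ compositions (suc k) N →
    ∑[ j₀ < suc k ] (Π d * stepFactor (blockSum a f j₀) (V.lookup d j₀))
      ≡ Π d * (+ 4 * + V.sum a - + 2 * + N + + suc k * + 3)
  factor-out {d} d∈ = begin
    ∑[ j₀ < suc k ] (Π d * stepFactor (blockSum a f j₀) (V.lookup d j₀))
      ≡⟨ *-distribˡ-sum (Π d) (λ j₀ → stepFactor (blockSum a f j₀) (V.lookup d j₀)) ⟨
    Π d * ∑[ j₀ < suc k ] stepFactor (blockSum a f j₀) (V.lookup d j₀)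
      ≡⟨ cong (_*_ (Π d)) (∑-stepFactor (blockSum a f) (V.lookup d)) ⟩
    Π d * (+ 4 * + ℕSum.sum (blockSum a f) - + 2 * + ℕSum.sum (V.lookup d) + + suc k * + 3)
      ≡⟨ cong₂ (λ A D → Π d * (+ 4 * + A - + 2 * + D + + suc k * + 3))
               (blockSum-total a f) (trans (ℕSum-lookup d) (∈-compositions⇒sum (suc k) N d∈)) ⟩
    Π d * (+ 4 * + V.sum a - + 2 * + N + + suc k * + 3)
      ∎

otherBlockWeights-punchIn : (a : Vec ℕ m) (g : Vec (Fin k) m) (j₀ : Fin (suc k)) (v : Vec ℕ k) →
  otherBlockWeights a (V.map (punchIn j₀) g) j₀ v ≡ Πℤ (L.allFin k) (blockWeights a g v)
otherBlockWeights-punchIn {k = k} a g j₀ v =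
  trans (Product.sum-cong-≗ λ i →
           cong₂ (λ s r → blockWeight s (V.lookup v i) r) (blockSum-punchIn j₀ a g i) (blockSize-punchIn j₀ g i))
        (sym (Πℤ-allFin k (blockWeights a g v)))

partitionWeight-∷ʳ-difference-new-block : (a : Vec ℕ m) (g : Vec (Fin k) m) (j₀ : Fin (suc k)) (N : ℕ) →
  partitionWeight (a ∷ʳ 1) (V.map (punchIn j₀) g ∷ʳ j₀) (suc N)
    - partitionWeight (a ∷ʳ 0) (V.map (punchIn j₀) g ∷ʳ j₀) (suc N)
  ≡ partitionWeight a g N * + 3
partitionWeight-∷ʳ-difference-new-block {k = k} a g j₀ N = begin
  partitionWeight (a ∷ʳ 1) (f ∷ʳ j₀) (suc N) - partitionWeight (a ∷ʳ 0) (f ∷ʳ j₀) (suc N)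
    ≡⟨ partitionWeight-∷ʳ-difference a f j₀ N ⟩
  Σℤ (compositions (suc k) N) (λ d → Πℤ (L.allFin (suc k)) (blockWeights a f d) * stepFactor (blockSum a f j₀) (V.lookup d j₀))
    ≡⟨ Σℤ-cong (compositions (suc k) N) new-block ⟩
  Σℤ (compositions (suc k) N) (λ d → indicator (V.lookup d j₀ ≡ᵇ 0) * (R (V.removeAt d j₀) * + 3))
    ≡⟨ Σℤ-compositions-zero-at k j₀ N (λ v → R v * + 3) ⟩
  Σℤ (compositions k N) (λ v → R v * + 3)
    ≡⟨ Σℤ-*ʳ (compositions k N) R (+ 3) ⟩
  partitionWeight a g N * + 3
    ∎
  where
  open ≡-Reasoning
  f = V.map (punchIn j₀) g
  R : Vec ℕ k → ℤ
  R v = Πℤ (L.allFin k) (blockWeights a g v)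
  empty-block : ∀ e R → indicator (e ≡ᵇ 0) * R * stepFactor 0 e ≡ indicator (e ≡ᵇ 0) * (R * + 3)
  empty-block zero    R = ℤP.*-assoc (+ 1) R (+ 3)
  empty-block (suc e) R = trans (cong (_* stepFactor 0 (suc e)) (ℤP.*-zeroˡ R))
                                (trans (ℤP.*-zeroˡ (stepFactor 0 (suc e))) (sym (ℤP.*-zeroˡ (R * + 3))))
  new-block : ∀ d → Πℤ (L.allFin (suc k)) (blockWeights a f d) * stepFactor (blockSum a f j₀) (V.lookup d j₀)
                  ≡ indicator (V.lookup d j₀ ≡ᵇ 0) * (R (V.removeAt d j₀) * + 3)
  new-block d = begin
    Πℤ (L.allFin (suc k)) (blockWeights a f d) * stepFactor (blockSum a f j₀) e
      ≡⟨ cong (_* stepFactor (blockSum a f j₀) e) (blockWeights-remove a f j₀ d) ⟩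
    blockWeight (blockSum a f j₀) e (blockSize f j₀) * otherBlockWeights a f j₀ (V.removeAt d j₀) * stepFactor (blockSum a f j₀) e
      ≡⟨ cong₃ (λ s r o → blockWeight s e r * o * stepFactor s e)
               (blockSum-punchIn-self j₀ a g) (blockSize-punchIn-self j₀ g) (otherBlockWeights-punchIn a g j₀ (V.removeAt d j₀)) ⟩
    blockWeight 0 e 0 * R (V.removeAt d j₀) * stepFactor 0 e
      ≡⟨ cong (λ w → w * R (V.removeAt d j₀) * stepFactor 0 e) (blockWeight-empty e) ⟩
    indicator (e ≡ᵇ 0) * R (V.removeAt d j₀) * stepFactor 0 e
      ≡⟨ empty-block e (R (V.removeAt d j₀)) ⟩
    indicator (e ≡ᵇ 0) * (R (V.removeAt d j₀) * + 3)
      ∎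
    where e = V.lookup d j₀

partitionSum : (k : ℕ) → Vec ℕ m → ℕ → ℤ
partitionSum {m} k a N = Σℤ (orderedPartitions m k) (λ f → partitionWeight a f N)

partitionSum-assignments : ∀ k (a : Vec ℕ m) N →
  partitionSum k a N ≡ Σℤ (assignments m k) (λ f → indicator (surjective f) * partitionWeight a f N)
partitionSum-assignments {m} k a N =
  trans (Σℤ-filterᵇ _ (assignments m k) (λ f → partitionWeight a f N))
        (Σℤ-cong (assignments m k) λ f →
           cong (λ b → indicator b * partitionWeight a f N) (allᵇ-allFin k (λ j → 1 ≤ᵇ blockSize f j)))

module _ {k : ℕ} (a : Vec ℕ m) (N : ℕ) where

  private
    D : Vec (Fin (suc k)) m → Fin (suc k) → ℤ
    D f j₀ = partitionWeight (a ∷ʳ 1) (f ∷ʳ j₀) (suc N) - partitionWeight (a ∷ʳ 0) (f ∷ʳ j₀) (suc N)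

    joins : Vec (Fin (suc k)) m → Fin (suc k) → ℤ
    joins f j₀ = indicator (surjective f) * D f j₀

    opens : Vec (Fin (suc k)) m → Fin (suc k) → ℤ
    opens f j₀ = indicator (blockSize f j₀ ≡ᵇ 0) * (indicator (othersOccupied f j₀) * D f j₀)

  partitionSum-∷ʳ-difference-split :
    partitionSum (suc k) (a ∷ʳ 1) (suc N) - partitionSum (suc k) (a ∷ʳ 0) (suc N)
      ≡ Σℤ (assignments m (suc k)) (λ f → ∑[ j₀ < suc k ] joins f j₀)
        + ∑[ j₀ < suc k ] Σℤ (assignments m (suc k)) (λ f → opens f j₀)
  partitionSum-∷ʳ-difference-split = begin
    partitionSum (suc k) (a ∷ʳ 1) (suc N) - partitionSum (suc k) (a ∷ʳ 0) (suc N)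
      ≡⟨ cong₂ _-_ (partitionSum-assignments (suc k) (a ∷ʳ 1) (suc N)) (partitionSum-assignments (suc k) (a ∷ʳ 0) (suc N)) ⟩
    Σℤ (assignments (suc m) (suc k)) (χ 1) - Σℤ (assignments (suc m) (suc k)) (χ 0)
      ≡⟨ Σℤ-distrib-- (assignments (suc m) (suc k)) (χ 1) (χ 0) ⟨
    Σℤ (assignments (suc m) (suc k)) (λ f → χ 1 f - χ 0 f)
      ≡⟨ Σℤ-assignments-∷ʳ m (suc k) (λ f → χ 1 f - χ 0 f) ⟩
    Σℤ (assignments m (suc k)) (λ f → ∑[ j₀ < suc k ] (χ 1 (f ∷ʳ j₀) - χ 0 (f ∷ʳ j₀)))
      ≡⟨ Σℤ-cong (assignments m (suc k)) (λ f →
           trans (sum-cong-≗ (split f)) (∑-distrib-+ (joins f) (λ j₀ → opens f j₀))) ⟩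
    Σℤ (assignments m (suc k)) (λ f → ∑[ j₀ < suc k ] joins f j₀ + ∑[ j₀ < suc k ] opens f j₀)
      ≡⟨ Σℤ-distrib-+ (assignments m (suc k)) (λ f → ∑[ j₀ < suc k ] joins f j₀)
                                               (λ f → ∑[ j₀ < suc k ] opens f j₀) ⟩
    Σℤ (assignments m (suc k)) (λ f → ∑[ j₀ < suc k ] joins f j₀)
      + Σℤ (assignments m (suc k)) (λ f → ∑[ j₀ < suc k ] opens f j₀)
      ≡⟨ cong (_+_ (Σℤ (assignments m (suc k)) (λ f → ∑[ j₀ < suc k ] joins f j₀)))
              (Σℤ-∑-comm (assignments m (suc k)) (λ j₀ f → opens f j₀)) ⟩
    Σℤ (assignments m (suc k)) (λ f → ∑[ j₀ < suc k ] joins f j₀)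
      + ∑[ j₀ < suc k ] Σℤ (assignments m (suc k)) (λ f → opens f j₀)
      ∎
    where
    open ≡-Reasoning
    χ : ℕ → Vec (Fin (suc k)) (suc m) → ℤ
    χ x f = indicator (surjective f) * partitionWeight (a ∷ʳ x) f (suc N)
    split : ∀ f j₀ → χ 1 (f ∷ʳ j₀) - χ 0 (f ∷ʳ j₀) ≡ joins f j₀ + opens f j₀
    split f j₀ = begin
      χ 1 (f ∷ʳ j₀) - χ 0 (f ∷ʳ j₀)
        ≡⟨ *-distribˡ-- (indicator (surjective (f ∷ʳ j₀))) _ _ ⟨
      indicator (surjective (f ∷ʳ j₀)) * D f j₀
        ≡⟨ cong (λ b → indicator b * D f j₀) (surjective-∷ʳ f j₀) ⟩
      indicator (othersOccupied f j₀) * D f j₀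
        ≡⟨ cong (_* D f j₀) (indicator-split (blockSize f j₀) (othersOccupied f j₀)) ⟩
      (indicator ((1 ≤ᵇ blockSize f j₀) ∧ othersOccupied f j₀) + χ₀ * χ₁) * D f j₀
        ≡⟨ cong (λ b → (indicator b + χ₀ * χ₁) * D f j₀) (surjective-remove f j₀) ⟨
      (indicator (surjective f) + χ₀ * χ₁) * D f j₀
        ≡⟨ distribute (indicator (surjective f)) χ₀ χ₁ (D f j₀) ⟩
      joins f j₀ + opens f j₀
        ∎
      where
      χ₀ = indicator (blockSize f j₀ ≡ᵇ 0)
      χ₁ = indicator (othersOccupied f j₀)
      distribute : ∀ x y z w → (x + y * z) * w ≡ x * w + y * (z * w)
      distribute = solve-∀

  partitionSum-joins : Σℤ (assignments m (suc k)) (λ f → ∑[ j₀ < suc k ] joins f j₀)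
    ≡ partitionSum (suc k) a N * (+ 4 * + V.sum a - + 2 * + N + + suc k * + 3)
  partitionSum-joins = begin
    Σℤ (assignments m (suc k)) (λ f → ∑[ j₀ < suc k ] joins f j₀)
      ≡⟨ Σℤ-cong (assignments m (suc k)) (λ f → begin
           ∑[ j₀ < suc k ] joins f j₀
             ≡⟨ *-distribˡ-sum (indicator (surjective f)) (D f) ⟨
           indicator (surjective f) * ∑[ j₀ < suc k ] D f j₀
             ≡⟨ cong (_*_ (indicator (surjective f))) (partitionWeight-∷ʳ-difference-total a f N) ⟩
           indicator (surjective f) * (partitionWeight a f N * c)
             ≡⟨ ℤP.*-assoc (indicator (surjective f)) (partitionWeight a f N) c ⟨
           indicator (surjective f) * partitionWeight a f N * c
             ∎) ⟩
    Σℤ (assignments m (suc k)) (λ f → indicator (surjective f) * partitionWeight a f N * c)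
      ≡⟨ Σℤ-*ʳ (assignments m (suc k)) (λ f → indicator (surjective f) * partitionWeight a f N) c ⟩
    Σℤ (assignments m (suc k)) (λ f → indicator (surjective f) * partitionWeight a f N) * c
      ≡⟨ cong (_* c) (partitionSum-assignments (suc k) a N) ⟨
    partitionSum (suc k) a N * c
      ∎
    where
    open ≡-Reasoning
    c = + 4 * + V.sum a - + 2 * + N + + suc k * + 3

  partitionSum-opens : ∀ j₀ → Σℤ (assignments m (suc k)) (λ f → opens f j₀) ≡ partitionSum k a N * + 3
  partitionSum-opens j₀ = begin
    Σℤ (assignments m (suc k)) (λ f → opens f j₀)
      ≡⟨ Σℤ-assignments-avoiding m k j₀ (λ f → indicator (othersOccupied f j₀) * D f j₀) ⟩
    Σℤ (assignments m k) (λ g → indicator (othersOccupied (V.map (punchIn j₀) g) j₀) * D (V.map (punchIn j₀) g) j₀)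
      ≡⟨ Σℤ-cong (assignments m k) (λ g →
           cong₂ (λ b d → indicator b * d) (othersOccupied-punchIn g j₀) (partitionWeight-∷ʳ-difference-new-block a g j₀ N)) ⟩
    Σℤ (assignments m k) (λ g → indicator (surjective g) * (partitionWeight a g N * + 3))
      ≡⟨ Σℤ-cong (assignments m k) (λ g → sym (ℤP.*-assoc (indicator (surjective g)) (partitionWeight a g N) (+ 3))) ⟩
    Σℤ (assignments m k) (λ g → indicator (surjective g) * partitionWeight a g N * + 3)
      ≡⟨ Σℤ-*ʳ (assignments m k) (λ g → indicator (surjective g) * partitionWeight a g N) (+ 3) ⟩
    Σℤ (assignments m k) (λ g → indicator (surjective g) * partitionWeight a g N) * + 3
      ≡⟨ cong (_* + 3) (partitionSum-assignments k a N) ⟨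
    partitionSum k a N * + 3
      ∎
    where open ≡-Reasoning

  partitionSum-∷ʳ-difference :
    partitionSum (suc k) (a ∷ʳ 1) (suc N) - partitionSum (suc k) (a ∷ʳ 0) (suc N)
      ≡ partitionSum (suc k) a N * (+ 4 * + V.sum a - + 2 * + N + + suc k * + 3) + + suc k * (partitionSum k a N * + 3)
  partitionSum-∷ʳ-difference =
    trans partitionSum-∷ʳ-difference-split
          (cong₂ _+_ partitionSum-joins
                     (trans (sum-cong-≗ partitionSum-opens) (∑-const (suc k) (partitionSum k a N * + 3))))

all-positive⇒≤sum : ∀ k (φ : Fin k → ℕ) → Conj.sum (λ j → 1 ≤ᵇ φ j) ≡ true → k ≤ ℕSum.sum φ
all-positive⇒≤sum zero    φ _ = z≤n
all-positive⇒≤sum (suc k) φ all-positive with φ F.zero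
... | suc c = s≤s (ℕP.≤-trans (all-positive⇒≤sum k (φ ∘ F.suc) all-positive) (ℕP.m≤n+m _ c))

surjective⇒≤ : (f : Vec (Fin k) m) → surjective f ≡ true → k ≤ m
surjective⇒≤ {k = k} f surj = subst (k ≤_) (blockSize-total f) (all-positive⇒≤sum k (blockSize f) surj)

partitionSum-too-many-blocks : (a : Vec ℕ m) (N : ℕ) → partitionSum (suc m) a N ≡ + 0
partitionSum-too-many-blocks {m} a N =
  trans (partitionSum-assignments (suc m) a N)
        (Σℤ-zero (assignments m (suc m)) _ λ f → cong (_* partitionWeight a f N) (not-surjective f))
  where
  not-surjective : (f : Vec (Fin (suc m)) m) → indicator (surjective f) ≡ + 0
  not-surjective f with surjective f in surj
  ... | false = refl
  ... | true  = ⊥-elim (ℕP.<-irrefl refl (surjective⇒≤ f surj))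

partitionSum-no-blocks : (a : Vec ℕ (suc m)) (N : ℕ) → partitionSum 0 a N ≡ + 0
partitionSum-no-blocks a N = refl

-- Summation over the number of blocks

coeff*! : ∀ g j → coeff g j ℕ.* j ! ≡ (2 ℕ.* g ∸ 3 ℕ.+ j) !
coeff*! g j = m/n*n≡m {{j !≢0}} (m≤n⇒m!∣n! (ℕP.m≤n+m j (2 ℕ.* g ∸ 3)))

coeff-suc : ∀ g j → coeff g (suc j) ℕ.* suc j ≡ (2 ℕ.* g ∸ 3 ℕ.+ suc j) ℕ.* coeff g j
coeff-suc g j = ℕP.*-cancelʳ-≡ _ _ (j !) {{j !≢0}} (begin
  coeff g (suc j) ℕ.* suc j ℕ.* j !      ≡⟨ ℕP.*-assoc (coeff g (suc j)) (suc j) (j !) ⟩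
  coeff g (suc j) ℕ.* (suc j) !          ≡⟨ coeff*! g (suc j) ⟩
  (M ℕ.+ suc j) !                        ≡⟨ cong _! (ℕP.+-suc M j) ⟩
  suc (M ℕ.+ j) ℕ.* (M ℕ.+ j) !          ≡⟨ cong₂ ℕ._*_ (ℕP.+-suc M j) (coeff*! g j) ⟨
  (M ℕ.+ suc j) ℕ.* (coeff g j ℕ.* j !)  ≡⟨ ℕP.*-assoc (M ℕ.+ suc j) (coeff g j) (j !) ⟨
  (M ℕ.+ suc j) ℕ.* coeff g j ℕ.* j !    ∎)
  where
  open ≡-Reasoning
  M = 2 ℕ.* g ∸ 3

signedCoeff : ℕ → ℕ → ℤ
signedCoeff g k = (- + 1) ℤ.^ k * + coeff g k

signedCoeff-suc : ∀ g j → + suc j * signedCoeff g (suc j) ≡ - + (2 ℕ.* g ∸ 3 ℕ.+ suc j) * signedCoeff g j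
signedCoeff-suc g j = begin
  + suc j * (- + 1 * σ * + coeff g (suc j))        ≡⟨ reorder (+ suc j) σ (+ coeff g (suc j)) ⟩
  - + 1 * σ * (+ coeff g (suc j) * + suc j)        ≡⟨ cong (λ x → - + 1 * σ * x) cast-coeff-suc ⟩
  - + 1 * σ * (+ M′ * + coeff g j)                 ≡⟨ regroup σ (+ M′) (+ coeff g j) ⟩
  - + M′ * (σ * + coeff g j)                       ∎
  where
  open ≡-Reasoning
  σ = (- + 1) ℤ.^ j
  M′ = 2 ℕ.* g ∸ 3 ℕ.+ suc j
  cast-coeff-suc : + coeff g (suc j) * + suc j ≡ + M′ * + coeff g j
  cast-coeff-suc = trans (sym (ℤP.pos-* (coeff g (suc j)) (suc j)))
                         (trans (cong +_ (coeff-suc g j)) (ℤP.pos-* M′ (coeff g j)))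
  reorder : ∀ s σ c → s * (- + 1 * σ * c) ≡ - + 1 * σ * (c * s)
  reorder = solve-∀
  regroup : ∀ σ m c → - + 1 * σ * (m * c) ≡ - m * (σ * c)
  regroup = solve-∀

P-partitionSums : ∀ g m (a : Vec ℕ m) →
  P g m a ≡ Σℤ (L.upTo m) (λ k → signedCoeff g (suc k) * partitionSum (suc k) a (g ∸ 2 ℕ.+ m))
P-partitionSums g m a = Σℤ-map suc (L.upTo m) (λ k → signedCoeff g k * partitionSum k a (g ∸ 2 ℕ.+ m))

P-∷ʳ-difference : ∀ g m (a : Vec ℕ m) → let N = g ∸ 2 ℕ.+ m in
  P g (suc m) (a ∷ʳ 1) - P g (suc m) (a ∷ʳ 0)
    ≡ Σℤ (L.upTo (suc m)) (λ k →
        signedCoeff g (suc k) * (partitionSum (suc k) a N * (+ 4 * + V.sum a - + 2 * + N + + suc k * + 3))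
        + signedCoeff g (suc k) * (+ suc k * (partitionSum k a N * + 3)))
P-∷ʳ-difference g m a = begin
  P g (suc m) (a ∷ʳ 1) - P g (suc m) (a ∷ʳ 0)
    ≡⟨ cong₂ _-_ (P-partitionSums g (suc m) (a ∷ʳ 1)) (P-partitionSums g (suc m) (a ∷ʳ 0)) ⟩
  Σℤ (L.upTo (suc m)) (term 1) - Σℤ (L.upTo (suc m)) (term 0)
    ≡⟨ Σℤ-distrib-- (L.upTo (suc m)) (term 1) (term 0) ⟨
  Σℤ (L.upTo (suc m)) (λ k → term 1 k - term 0 k)
    ≡⟨ Σℤ-cong (L.upTo (suc m)) (λ k → begin
         term 1 k - term 0 k
           ≡⟨ *-distribˡ-- (signedCoeff g (suc k)) _ _ ⟨
         signedCoeff g (suc k) * (partitionSum (suc k) (a ∷ʳ 1) M - partitionSum (suc k) (a ∷ʳ 0) M)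
           ≡⟨ cong (λ M → signedCoeff g (suc k) * (partitionSum (suc k) (a ∷ʳ 1) M - partitionSum (suc k) (a ∷ʳ 0) M))
                   (ℕP.+-suc (g ∸ 2) m) ⟩
         signedCoeff g (suc k) * (partitionSum (suc k) (a ∷ʳ 1) (suc N) - partitionSum (suc k) (a ∷ʳ 0) (suc N))
           ≡⟨ cong (_*_ (signedCoeff g (suc k))) (partitionSum-∷ʳ-difference a N) ⟩
         signedCoeff g (suc k) * (partitionSum (suc k) a N * (+ 4 * + V.sum a - + 2 * + N + + suc k * + 3)
                                   + + suc k * (partitionSum k a N * + 3))
           ≡⟨ ℤP.*-distribˡ-+ (signedCoeff g (suc k)) _ _ ⟩
         signedCoeff g (suc k) * (partitionSum (suc k) a N * (+ 4 * + V.sum a - + 2 * + N + + suc k * + 3))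
           + signedCoeff g (suc k) * (+ suc k * (partitionSum k a N * + 3))
           ∎) ⟩
  Σℤ (L.upTo (suc m)) (λ k →
    signedCoeff g (suc k) * (partitionSum (suc k) a N * (+ 4 * + V.sum a - + 2 * + N + + suc k * + 3))
    + signedCoeff g (suc k) * (+ suc k * (partitionSum k a N * + 3)))
    ∎
  where
  open ≡-Reasoning
  N = g ∸ 2 ℕ.+ m
  M = g ∸ 2 ℕ.+ suc m
  term : ℕ → ℕ → ℤ
  term x k = signedCoeff g (suc k) * partitionSum (suc k) (a ∷ʳ x) M

signedCoeff-telescope : ∀ h n k s (Q : ℤ) → let g = suc (suc h) in
  signedCoeff g (suc k) * (Q * (+ 4 * + s - + 2 * + (h ℕ.+ n) + + suc k * + 3))
    + signedCoeff g (suc (suc k)) * (+ suc (suc k) * (Q * + 3))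
  ≡ signedCoeff g (suc k) * Q * (+ (4 ℕ.* s) - + (8 ℕ.* g) + + 10 - + (2 ℕ.* n))
signedCoeff-telescope h n k s Q = begin
  c₁ * (Q * x) + c₂ * (+ suc (suc k) * (Q * + 3))
    ≡⟨ cong (_+_ (c₁ * (Q * x))) (pull-out c₂ (+ suc (suc k)) Q) ⟩
  c₁ * (Q * x) + + suc (suc k) * c₂ * (Q * + 3)
    ≡⟨ cong (λ y → c₁ * (Q * x) + y * (Q * + 3)) (signedCoeff-suc g (suc k)) ⟩
  c₁ * (Q * x) + - + (2 ℕ.* g ∸ 3 ℕ.+ suc (suc k)) * c₁ * (Q * + 3)
    ≡⟨ cong (λ y → c₁ * (Q * x) + - y * c₁ * (Q * + 3)) cast-index ⟩
  c₁ * (Q * x) + - (+ 2 * + h + + 3 + + k) * c₁ * (Q * + 3)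
    ≡⟨ collect c₁ Q (+ s) (+ h) (+ n) (+ k) ⟩
  c₁ * Q * (+ 4 * + s - + 8 * + g + + 10 - + 2 * + n)
    ≡⟨ cong₃ (λ u v w → c₁ * Q * (u - v + + 10 - w)) (ℤP.pos-* 4 s) (ℤP.pos-* 8 g) (ℤP.pos-* 2 n) ⟨
  c₁ * Q * (+ (4 ℕ.* s) - + (8 ℕ.* g) + + 10 - + (2 ℕ.* n))
    ∎
  where
  open ≡-Reasoning
  g = suc (suc h)
  c₁ = signedCoeff g (suc k)
  c₂ = signedCoeff g (suc (suc k))
  x = + 4 * + s - + 2 * + (h ℕ.+ n) + + suc k * + 3
  cast-index : + (2 ℕ.* g ∸ 3 ℕ.+ suc (suc k)) ≡ + 2 * + h + + 3 + + k
  cast-index = begin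
    + (2 ℕ.* g ∸ 3 ℕ.+ suc (suc k))
      ≡⟨ cong (λ t → + (t ∸ 3 ℕ.+ suc (suc k))) (trans (ℕP.*-suc 2 (suc h)) (cong (2 ℕ.+_) (ℕP.*-suc 2 h))) ⟩
    + (suc (2 ℕ.* h) ℕ.+ suc (suc k))
      ≡⟨ trans (ℤP.pos-+ (suc (2 ℕ.* h)) (suc (suc k))) (cong (λ t → + 1 + t + (+ 2 + + k)) (ℤP.pos-* 2 h)) ⟩
    + 1 + + 2 * + h + (+ 2 + + k)
      ≡⟨ regroup (+ h) (+ k) ⟩
    + 2 * + h + + 3 + + k
      ∎
    where
    regroup : ∀ h k → + 1 + + 2 * h + (+ 2 + k) ≡ + 2 * h + + 3 + k
    regroup = solve-∀
  pull-out : ∀ c K Q → c * (K * (Q * + 3)) ≡ K * c * (Q * + 3)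
  pull-out = solve-∀
  collect : ∀ c Q s h n k → c * (Q * (+ 4 * s - + 2 * (h + n) + (+ 1 + k) * + 3)) + - (+ 2 * h + + 3 + k) * c * (Q * + 3)
                         ≡ c * Q * (+ 4 * s - + 8 * (+ 2 + h) + + 10 - + 2 * n)
  collect = solve-∀

proposition5p5 : (g : ℕ) → 2 ≤ g → (n : ℕ) → 1 ≤ n → (a : Vec ℕ n) →
    P g (suc n) (a ∷ʳ 1) ℤ.- P g (suc n) (a ∷ʳ 0)
    ≡ P g n a ℤ.* (+ (4 ℕ.* V.sum a) ℤ.- + (8 ℕ.* g) ℤ.+ + 10 ℤ.- + (2 ℕ.* n))
proposition5p5 g@(suc (suc h)) (s≤s (s≤s z≤n)) n@(suc _) (s≤s z≤n) a = begin
  P g (suc n) (a ∷ʳ 1) - P g (suc n) (a ∷ʳ 0)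
    ≡⟨ P-∷ʳ-difference g n a ⟩
  Σℤ (L.upTo (suc n)) (λ k → joined k + opened k)
    ≡⟨ Σℤ-upTo-telescope n joined opened joined-last opened-first ⟩
  Σℤ (L.upTo n) (λ k → joined k + opened (suc k))
    ≡⟨ Σℤ-cong (L.upTo n) (λ k → signedCoeff-telescope h n k (V.sum a) (partitionSum (suc k) a N)) ⟩
  Σℤ (L.upTo n) (λ k → signedCoeff g (suc k) * partitionSum (suc k) a N * X)
    ≡⟨ Σℤ-*ʳ (L.upTo n) (λ k → signedCoeff g (suc k) * partitionSum (suc k) a N) X ⟩
  Σℤ (L.upTo n) (λ k → signedCoeff g (suc k) * partitionSum (suc k) a N) * X
    ≡⟨ cong (_* X) (P-partitionSums g n a) ⟨
  P g n a * X
    ∎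
  where
  open ≡-Reasoning
  N = h ℕ.+ n
  X = + (4 ℕ.* V.sum a) - + (8 ℕ.* g) + + 10 - + (2 ℕ.* n)
  joined opened : ℕ → ℤ
  joined k = signedCoeff g (suc k) * (partitionSum (suc k) a N * (+ 4 * + V.sum a - + 2 * + N + + suc k * + 3))
  opened k = signedCoeff g (suc k) * (+ suc k * (partitionSum k a N * + 3))
  joined-last : joined n ≡ + 0
  joined-last = trans (cong (λ Q → signedCoeff g (suc n) * (Q * (+ 4 * + V.sum a - + 2 * + N + + suc n * + 3)))
                            (partitionSum-too-many-blocks a N))
                      (ℤP.*-zeroʳ (signedCoeff g (suc n)))
  opened-first : opened 0 ≡ + 0
  opened-first = trans (cong (λ Q → signedCoeff g 1 * (+ 1 * (Q * + 3))) (partitionSum-no-blocks a N))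
                       (ℤP.*-zeroʳ (signedCoeff g 1))
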